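{- Let $p$ be a prime, $k$ a positive integer, $S=\{p^k\}$ and $M=\operatorname{ssift}(S)$. Then \[M=\{n\in\mathbb{N}_+ : \operatorname{val}_p(n)\equiv 0,1,\dots,k-1 \pmod{2k}\}.\]
   Context: For $S\subseteq\mathbb{N}\setminus\{0,1\}$, the selective sifting $\operatorname{ssift}(S)\subseteq\mathbb{N}_+$ is defined inductively: $1\in\operatorname{ssift}(S)$, and for $n>1$, $n\in\operatorname{ssift}(S)$ if and only if $n$ is not of the form $ab$ with $a\in S$, $b\in\operatorname{ssift}(S)$ and $1\le b<n$. $\operatorname{val}_p(n)=\max\{a: p^a\mid n\}$. -}

module Defs where

open import Data.Nat using (ℕ; zero; suc; _*_; _^_; _≤_; _≡ᵇ_; _≤ᵇ_)
open import Data.Nat.Divisibility using (_∣_)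
open import Data.Bool using (Bool; true; false; _∧_; _∨_; not)
open import Data.List using (List; upTo)
open import Data.Bool.ListAction using (any)
open import Data.Product using (_×_)
open import Relation.Unary using (Pred; Decidable)
open import Relation.Nullary using (does)
open import Level using (0ℓ)

-- Selective sifting, computed by recursion on a fuel parameter.
-- ssiftF S? f n decides membership of n in ssift(S), valid when n ≤ f.
-- For n > 1: n ∈ ssift(S) iff there is no b with 1 ≤ b < n, b ∈ ssift(S),
-- and a ∈ S (a ≤ n necessarily) with a * b = n.
ssiftF : {S : Pred ℕ 0ℓ} → Decidable S → ℕ → ℕ → Bool
ssiftF S? zero    n = false
ssiftF S? (suc f) n =
  (n ≡ᵇ 1) ∨
  (not (n ≡ᵇ 0) ∧
   not (any (λ b → (1 ≤ᵇ b) ∧ ssiftF S? f b ∧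
                   any (λ a → does (S? a) ∧ (a * b ≡ᵇ n)) (upTo (suc n)))
            (upTo n)))

-- membership of n in ssift(S) (as a Boolean); 0 is never a member.
ssift : {S : Pred ℕ 0ℓ} → Decidable S → ℕ → Bool
ssift S? n = ssiftF S? n n

IsVal : ℕ → ℕ → ℕ → Set
IsVal p n v = (p ^ v ∣ n) × (∀ a → p ^ a ∣ n → a ≤ v)

module Submission where

-- An n with val_p n < k is not divisible by p^k, so nothing can sift it out. If p^k ∣ n, the only
-- candidate witness is n / p^k, whose valuation is val_p n − k; hence n survives exactly when
-- n / p^k does not, and membership flips each time the valuation drops by k.

open import Defs
open import Data.Nat using (ℕ; _^_; _*_; _+_; _<_; _≤_; _≟_)
open import Data.Nat.Primality using (Prime)
open import Data.Bool using (T)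
open import Data.Product using (_×_; ∃-syntax)
open import Function.Bundles using (_⇔_)
open import Relation.Binary.PropositionalEquality using (_≡_)

open import Level using (0ℓ)
open import Data.Nat
  using (zero; suc; _∸_; _%_; _/_; _≡ᵇ_; _≤ᵇ_; NonZero; >-nonZero; >-nonZero⁻¹; z≤n; s≤s; _<?_)
open import Data.Nat.Properties
open import Data.Nat.DivMod
  using (m≡m%n+[m/n]*n; m%n<n; m<n⇒m%n≡m; [m+n]%n≡m%n; [m+kn]%n≡m%n; %-distribˡ-+)
open import Data.Nat.Divisibility
  using (_∣_; divides; quotient; m∣n⇒n≡m*quotient; *-cancelˡ-∣; *-monoʳ-∣; m∣m*n; ∣-trans)
open import Data.Nat.Primality using (prime⇒nonTrivial)
open import Data.Nat.Base using (nonTrivial⇒n>1)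
open import Data.Bool using (Bool; true; false; not; _∧_)
open import Data.Bool.Properties using (T-∧)
open import Data.Bool.ListAction using (any)
open import Data.List using (upTo)
open import Data.List.Relation.Unary.Any.Properties using (any⇔)
open import Data.List.Membership.Propositional using (find; lose)
open import Data.List.Membership.Propositional.Properties using (∈-upTo⁺; ∈-upTo⁻)
open import Data.Product using (_,_)
open import Data.Unit using (tt)
open import Relation.Nullary using (¬_; Dec; yes; no; does; contradiction; contraposition)
open import Relation.Unary using (Pred; Decidable)
open import Relation.Binary.PropositionalEquality
  using (refl; sym; trans; cong; subst; subst₂; module ≡-Reasoning)
open import Function.Base using (_∘_)
open import Function.Bundles using (mk⇔; Equivalence)
open import Function.Properties.Equivalence using () renaming (trans to ⇔-trans; sym to ⇔-sym)

open Equivalence using (to; from)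

T-not : ∀ {b} → T (not b) ⇔ (¬ T b)
T-not {true}  = mk⇔ (λ ()) (λ ¬t → ¬t tt)
T-not {false} = mk⇔ (λ _ ()) (λ _ → tt)

T-does : ∀ {A : Set} (a? : Dec A) → T (does a?) ⇔ A
T-does (yes a) = mk⇔ (λ _ → a) (λ _ → tt)
T-does (no ¬a) = mk⇔ (λ ()) ¬a

¬-cong : ∀ {A B : Set} → A ⇔ B → (¬ A) ⇔ (¬ B)
¬-cong A⇔B = mk⇔ (contraposition (from A⇔B)) (contraposition (to A⇔B))

T-any-upTo : ∀ (P : ℕ → Bool) n → T (any P (upTo n)) ⇔ (∃[ i ] (i < n × T (P i)))
T-any-upTo P n = mk⇔ witness (λ (i , i<n , Pi) → to any⇔ (lose (∈-upTo⁺ i<n) Pi))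
  where
  witness : T (any P (upTo n)) → ∃[ i ] (i < n × T (P i))
  witness h with i , i∈ , Pi ← find (from any⇔ h) = i , ∈-upTo⁻ i∈ , Pi

module _ {S : Pred ℕ 0ℓ} (S? : Decidable S) where

  SiftedOut : ℕ → ℕ → Set
  SiftedOut f n = ∃[ b ] (1 ≤ b × b < n × T (ssiftF S? f b) × ∃[ a ] (S a × a * b ≡ n))

  ssiftF-step : ∀ f n → 2 ≤ n → T (ssiftF S? (suc f) n) ⇔ (¬ SiftedOut f n)
  ssiftF-step f 1 (s≤s ())
  ssiftF-step f n@(suc (suc _)) _ = ⇔-trans T-not (¬-cong anyDivisor)
    where
    factorOf? : ℕ → Bool
    factorOf? b = any (λ a → does (S? a) ∧ (a * b ≡ᵇ n)) (upTo (suc n))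

    factor : ∀ b → 1 ≤ b → T (factorOf? b) ⇔ (∃[ a ] (S a × a * b ≡ n))
    factor b 1≤b = ⇔-trans (T-any-upTo _ (suc n)) (mk⇔
      (λ (a , _ , h) → let (Sa , e) = to T-∧ h in a , to (T-does (S? a)) Sa , ≡ᵇ⇒≡ (a * b) n e)
      (λ (a , Sa , e) → a , s≤s (subst (a ≤_) e (m≤m*n a b {{>-nonZero 1≤b}}))
                          , from T-∧ (from (T-does (S? a)) Sa , ≡⇒≡ᵇ (a * b) n e)))
    anyDivisor : T (any (λ b → (1 ≤ᵇ b) ∧ ssiftF S? f b ∧ factorOf? b) (upTo n)) ⇔ SiftedOut f n
    anyDivisor = ⇔-trans (T-any-upTo _ n) (mk⇔
      (λ (b , b<n , h) → let (1≤b , h′) = to T-∧ h ; (sb , ha) = to T-∧ h′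
                          in b , ≤ᵇ⇒≤ 1 b 1≤b , b<n , sb , to (factor b (≤ᵇ⇒≤ 1 b 1≤b)) ha)
      (λ (b , 1≤b , b<n , sb , ha) →
         b , b<n , from T-∧ (≤⇒≤ᵇ 1≤b , from T-∧ (sb , from (factor b 1≤b) ha))))

module _ (q : ℕ) (1<q : 1 < q) where

  private
    Sifted : ℕ → ℕ → Bool
    Sifted = ssiftF (_≟ q)

  ssiftF-singleton-∤ : ∀ f n → 1 ≤ n → ¬ q ∣ n → T (Sifted (suc f) n)
  ssiftF-singleton-∤ f 1 _ _ = tt
  ssiftF-singleton-∤ f n@(suc (suc _)) _ q∤n =
    from (ssiftF-step (_≟ q) f n (s≤s (s≤s z≤n)))
         λ { (b , _ , _ , _ , _ , refl , qb≡n) → q∤n (divides b (trans (sym qb≡n) (*-comm q b))) }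

  ssiftF-singleton-* : ∀ f b → 1 ≤ b → T (Sifted (suc f) (q * b)) ⇔ (¬ T (Sifted f b))
  ssiftF-singleton-* f b 1≤b =
    ⇔-trans (ssiftF-step (_≟ q) f (q * b) (*-mono-≤ 1<q 1≤b))
            (¬-cong (mk⇔ quotientSifted siftedBy))
    where
    instance
      b≢0 : NonZero b
      b≢0 = >-nonZero 1≤b
      q≢0 : NonZero q
      q≢0 = >-nonZero (<-trans (s≤s z≤n) 1<q)

    quotientSifted : SiftedOut (_≟ q) f (q * b) → T (Sifted f b)
    quotientSifted (b′ , _ , _ , sb′ , _ , refl , qb′≡qb) =
      subst (T ∘ Sifted f) (*-cancelˡ-≡ b′ b q qb′≡qb) sb′

    siftedBy : T (Sifted f b) → SiftedOut (_≟ q) f (q * b)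
    siftedBy sb = b , 1≤b , subst (b <_) (*-comm b q) (m<m*n b q 1<q) , sb , q , refl , refl

module _ {p : ℕ} .{{_ : NonZero p}} where

  ^-split : ∀ {k v} → k ≤ v → p ^ v ≡ p ^ k * p ^ (v ∸ k)
  ^-split {k} {v} k≤v = trans (cong (p ^_) (sym (m+[n∸m]≡n k≤v))) (^-distribˡ-+-* p k (v ∸ k))

  IsVal-∤ : ∀ {n v k} → IsVal p n v → v < k → ¬ p ^ k ∣ n
  IsVal-∤ (_ , maximal) v<k pᵏ∣n = <⇒≱ v<k (maximal _ pᵏ∣n)

  IsVal-∣ : ∀ {n v k} → IsVal p n v → k ≤ v → p ^ k ∣ n
  IsVal-∣ (pᵛ∣n , _) k≤v = ∣-trans (subst (_ ∣_) (sym (^-split k≤v)) (m∣m*n _)) pᵛ∣n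

  IsVal-*ˡ : ∀ {b v} k → IsVal p (p ^ k * b) v → k ≤ v → IsVal p b (v ∸ k)
  IsVal-*ˡ {b} {v} k (pᵛ∣n , maximal) k≤v =
    *-cancelˡ-∣ (p ^ k) {{m^n≢0 p k}} (subst (_∣ p ^ k * b) (^-split k≤v) pᵛ∣n) ,
    λ a pᵃ∣b → m+n≤o⇒m≤o∸n a (subst (_≤ v) (+-comm k a)
      (maximal (k + a)
        (subst (_∣ p ^ k * b) (sym (^-distribˡ-+-* p k a)) (*-monoʳ-∣ (p ^ k) pᵃ∣b))))

LowerHalf : ℕ → ℕ → Set
LowerHalf k v = ∃[ r ] (r < k × ∃[ q ] (v ≡ r + q * (2 * k)))

module _ {k : ℕ} .{{_ : NonZero k}} where

  private
    instance
      2k≢0 : NonZero (2 * k)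
      2k≢0 = m*n≢0 2 k

    2k≡k+k : 2 * k ≡ k + k
    2k≡k+k = cong (k +_) (+-identityʳ k)

    k<2k : k < 2 * k
    k<2k = subst (k <_) (sym 2k≡k+k) (m<m+n k (>-nonZero⁻¹ k))

  LowerHalf⇔%< : ∀ v → LowerHalf k v ⇔ (v % (2 * k) < k)
  LowerHalf⇔%< v = mk⇔
    (λ { (r , r<k , q , refl) → subst (_< k) (sym (residue r q r<k)) r<k })
    (λ r<k → v % (2 * k) , r<k , v / (2 * k) , m≡m%n+[m/n]*n v (2 * k))
    where
    residue : ∀ r q → r < k → (r + q * (2 * k)) % (2 * k) ≡ r
    residue r q r<k = trans ([m+kn]%n≡m%n r q (2 * k)) (m<n⇒m%n≡m (<-trans r<k k<2k))

  LowerHalf-small : ∀ {v} → v < k → LowerHalf k v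
  LowerHalf-small {v} v<k = v , v<k , 0 , sym (+-identityʳ v)

  residue-+k : ∀ r → r < 2 * k → ((r + k) % (2 * k) < k) ⇔ (¬ r < k)
  residue-+k r r<2k with r <? k
  ... | yes r<k = mk⇔ (λ r+k%<k _ → <⇒≱ (subst (_< k) r+k%≡r+k r+k%<k) (m≤n+m k r))
                      (λ r≮k → contradiction r<k r≮k)
    where
    r+k%≡r+k : (r + k) % (2 * k) ≡ r + k
    r+k%≡r+k = m<n⇒m%n≡m (subst (r + k <_) (sym 2k≡k+k) (+-monoˡ-< k r<k))
  ... | no r≮k = mk⇔ (λ _ → r≮k) (λ _ → subst (_< k) (sym r+k%≡r∸k) r∸k<k)
    where
    k≤r : k ≤ r
    k≤r = ≮⇒≥ r≮k
    r∸k<k : r ∸ k < k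
    r∸k<k = +-cancelʳ-< k (r ∸ k) k (subst₂ _<_ (sym (m∸n+n≡m k≤r)) 2k≡k+k r<2k)
    r+k≡r∸k+2k : r + k ≡ r ∸ k + 2 * k
    r+k≡r∸k+2k = begin
      r + k             ≡⟨ cong (_+ k) (sym (m∸n+n≡m k≤r)) ⟩
      r ∸ k + k + k     ≡⟨ +-assoc (r ∸ k) k k ⟩
      r ∸ k + (k + k)   ≡⟨ cong (r ∸ k +_) (sym 2k≡k+k) ⟩
      r ∸ k + 2 * k     ∎
      where open ≡-Reasoning
    r+k%≡r∸k : (r + k) % (2 * k) ≡ r ∸ k
    r+k%≡r∸k = trans (cong (_% (2 * k)) r+k≡r∸k+2k)
                     (trans ([m+n]%n≡m%n (r ∸ k) (2 * k)) (m<n⇒m%n≡m (<-trans r∸k<k k<2k)))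

  LowerHalf-+k : ∀ w → LowerHalf k (w + k) ⇔ (¬ LowerHalf k w)
  LowerHalf-+k w =
    ⇔-trans (LowerHalf⇔%< (w + k))
    (⇔-trans (mk⇔ (subst (_< k) %-shift) (subst (_< k) (sym %-shift)))
    (⇔-trans (residue-+k (w % (2 * k)) (m%n<n w (2 * k)))
             (¬-cong (⇔-sym (LowerHalf⇔%< w)))))
    where
    %-shift : (w + k) % (2 * k) ≡ (w % (2 * k) + k) % (2 * k)
    %-shift = trans (%-distribˡ-+ w k (2 * k))
                    (cong (λ x → (w % (2 * k) + x) % (2 * k)) (m<n⇒m%n≡m k<2k))

  LowerHalf-∸k : ∀ {v} → k ≤ v → LowerHalf k v ⇔ (¬ LowerHalf k (v ∸ k))
  LowerHalf-∸k {v} k≤v =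
    subst (λ u → LowerHalf k u ⇔ (¬ LowerHalf k (v ∸ k))) (m∸n+n≡m k≤v) (LowerHalf-+k (v ∸ k))

module _ {p k : ℕ} (1<p : 1 < p) (1≤k : 1 ≤ k) where

  private
    instance
      p≢0 : NonZero p
      p≢0 = >-nonZero (<⇒≤ 1<p)
      k≢0 : NonZero k
      k≢0 = >-nonZero 1≤k

    1<pᵏ : 1 < p ^ k
    1<pᵏ = ^-monoʳ-< p 1<p {0} {k} 1≤k

  ssiftF-pᵏ-val : ∀ f n v → 1 ≤ n → n ≤ f → IsVal p n v →
                  T (ssiftF (_≟ p ^ k) f n) ⇔ LowerHalf k v
  ssiftF-pᵏ-val zero (suc _) _ _ () _
  ssiftF-pᵏ-val (suc f) n v 1≤n n≤f val with v <? k
  ... | yes v<k = mk⇔ (λ _ → LowerHalf-small v<k)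
                      (λ _ → ssiftF-singleton-∤ (p ^ k) 1<pᵏ f n 1≤n (IsVal-∤ val v<k))
  ... | no v≮k = ⇔-trans n⇔¬b (⇔-trans (¬-cong b⇔lower) (⇔-sym (LowerHalf-∸k k≤v)))
    where
    k≤v : k ≤ v
    k≤v = ≮⇒≥ v≮k
    pᵏ∣n : p ^ k ∣ n
    pᵏ∣n = IsVal-∣ val k≤v
    b : ℕ
    b = quotient pᵏ∣n
    n≡pᵏb : n ≡ p ^ k * b
    n≡pᵏb = m∣n⇒n≡m*quotient pᵏ∣n
    1≤b : 1 ≤ b
    1≤b = >-nonZero⁻¹ b {{m*n≢0⇒n≢0 (p ^ k) {{subst NonZero n≡pᵏb (>-nonZero 1≤n)}}}}
    b<n : b < n
    b<n = subst (b <_) (trans (*-comm b (p ^ k)) (sym n≡pᵏb)) (m<m*n b (p ^ k) {{>-nonZero 1≤b}} 1<pᵏ)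

    n⇔¬b : T (ssiftF (_≟ p ^ k) (suc f) n) ⇔ (¬ T (ssiftF (_≟ p ^ k) f b))
    n⇔¬b = subst (λ m → T (ssiftF (_≟ p ^ k) (suc f) m) ⇔ (¬ T (ssiftF (_≟ p ^ k) f b)))
                 (sym n≡pᵏb) (ssiftF-singleton-* (p ^ k) 1<pᵏ f b 1≤b)
    b⇔lower : T (ssiftF (_≟ p ^ k) f b) ⇔ LowerHalf k (v ∸ k)
    b⇔lower = ssiftF-pᵏ-val f b (v ∸ k) 1≤b (≤-pred (≤-trans b<n n≤f))
                (IsVal-*ˡ k (subst (λ m → IsVal p m v) n≡pᵏb val) k≤v)

mainTheorem9 : ∀ (p k : ℕ) → Prime p → 1 ≤ k →
    ∀ (n : ℕ) → 1 ≤ n → ∀ (v : ℕ) → IsVal p n v →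
    (T (ssift {λ a → a ≡ p ^ k} (λ a → a ≟ p ^ k) n)
      ⇔ (∃[ r ] (r < k × ∃[ q ] (v ≡ r + q * (2 * k)))))
mainTheorem9 p k p-prime 1≤k n 1≤n v val =
  ssiftF-pᵏ-val (nonTrivial⇒n>1 p {{prime⇒nonTrivial p-prime}}) 1≤k n n v 1≤n ≤-refl val
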